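{- Let $G$ be the cube graph, let $P$ be a pot satisfying Scenario 3 for $G$, and let $\lambda$ be an assembly design of $G$ with $P_\lambda(G)\subseteq P$. Then there are at most two distinct tiles $t\in P$ each of which is assigned by $\lambda$ to two distinct vertices of $G$; equivalently, there cannot be three pairwise disjoint pairs of vertices $\{v_i,v_j\}$, $v_i\ne v_j$, with $\lambda(v_i)=\lambda(v_j)$ and with the three corresponding tiles pairwise distinct.
   Context: The cube graph is the 1-skeleton of the 3-dimensional cube ($3$-regular, $8$ vertices). Graphs are finite and may have loops and multiple edges; each edge $e$ with endpoints $u,v$ has half-edges $(u,e),(v,e)$. Fix a finite alphabet $\Sigma$ (bond-edge types) and disjoint copy $\hat\Sigma=\{\hat a:a\in\Sigma\}$; elements of $\Sigma\cup\hat\Sigma$ are cohesive-end types, $\hat{\hat a}=a$. A tile is a finite multiset of cohesive-end types. A pot is a finite set $P$ of tiles such that whenever $x$ occurs in a tile of $P$, $\hat x$ occurs in some tile of $P$. An assembly design of a graph $G$ labels half-edges by cohesive-end types so that the two half-edges of each edge receive $a$ and $\hat a$ for some $a\in\Sigma$; $\lambda(v)$ is the multiset of labels at $v$ and $P_\lambda(G)=\{\lambda(v)\}$. $P$ realizes $G$ if $P_\lambda(G)\subseteq P$ for some assembly design $\lambda$; $\mathcal O(P)$ is the set of graphs realized by $P$. $P$ satisfies Scenario 3 for $G$ if $G\in\mathcal O(P)$, every $H\in\mathcal O(P)$ has $\#V(H)\ge\#V(G)$, and every $H\in\mathcal O(P)$ with $\#V(H)=\#V(G)$ is isomorphic to $G$.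 -}

module Defs where

open import Data.Nat using (ℕ; zero; suc; _+_; _*_; _≤_; _<_)
open import Data.Bool using (Bool; true; false; not)
open import Data.Fin using (Fin; #_) renaming (zero to fzero; suc to fsuc)
open import Data.Fin.Properties using () renaming (_≟_ to _≟ᶠ_)
open import Data.Bool.Properties using () renaming (_≟_ to _≟ᵇ_)
open import Data.Vec using (Vec; lookup; tabulate; []; _∷_)
open import Data.List using (List)
open import Data.List.Membership.Propositional using (_∈_)
open import Data.Product using (Σ; _×_; _,_; proj₁; proj₂; ∃)
open import Data.Sum using (_⊎_)
open import Relation.Nullary using (¬_; Dec; yes; no)
open import Relation.Binary.PropositionalEquality using (_≡_; _≢_; refl)
open import Function.Bundles using (_↔_; Inverse)

-- Finite multigraphs (loops and multiple edges allowed).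
-- Vertices Fin nV, edges Fin nE; the half-edges of edge e are (e , false)
-- and (e , true); ends e s is the endpoint carrying half-edge (e , s).

record Graph : Set where
  field
    nV    : ℕ
    nE    : ℕ
    ends  : Fin nE → Bool → Fin nV
open Graph public

record Iso (G H : Graph) : Set where
  field
    vmap : Fin (nV G) ↔ Fin (nV H)
    emap : Fin (nE G) ↔ Fin (nE H)
    compat : ∀ e →
      ( (ends H (Inverse.to emap e) false ≡ Inverse.to vmap (ends G e false))
      × (ends H (Inverse.to emap e) true  ≡ Inverse.to vmap (ends G e true)) )
      ⊎
      ( (ends H (Inverse.to emap e) false ≡ Inverse.to vmap (ends G e true))
      × (ends H (Inverse.to emap e) true  ≡ Inverse.to vmap (ends G e false)) )

-- The cube graph Q3: vertices 0..7 as 3-bit strings, edges join strings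
-- differing in exactly one bit.

cubeEdges : Vec (Fin 8 × Fin 8) 12
cubeEdges =
  (# 0 , # 1) ∷ (# 2 , # 3) ∷ (# 4 , # 5) ∷ (# 6 , # 7) ∷
  (# 0 , # 2) ∷ (# 1 , # 3) ∷ (# 4 , # 6) ∷ (# 5 , # 7) ∷
  (# 0 , # 4) ∷ (# 1 , # 5) ∷ (# 2 , # 6) ∷ (# 3 , # 7) ∷ []

cube : Graph
cube = record
  { nV = 8
  ; nE = 12
  ; ends = λ e s → endOf (lookup cubeEdges e) s
  }
  where
  endOf : Fin 8 × Fin 8 → Bool → Fin 8
  endOf (u , v) false = u
  endOf (u , v) true  = v

-- Cohesive-end types over the alphabet Σ = Fin k:
-- (a , false) is a, (a , true) is â.

CE : ℕ → Set
CE k = Fin k × Bool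

hat : ∀ {k} → CE k → CE k
hat (a , b) = (a , not b)

-- Tiles: finite multisets of cohesive-end types, given by their
-- multiplicity vectors (plain counts , hatted counts).
Tile : ℕ → Set
Tile k = Vec ℕ k × Vec ℕ k

mult : ∀ {k} → Tile k → CE k → ℕ
mult t (a , false) = lookup (proj₁ t) a
mult t (a , true)  = lookup (proj₂ t) a

occurs : ∀ {k} → CE k → Tile k → Set
occurs x t = 0 < mult t x

-- A pot: a finite set of tiles (a list; repetitions are irrelevant)
-- closed under complementary cohesive ends.
Pot : ℕ → Set
Pot k = List (Tile k)

IsPot : ∀ {k} → Pot k → Set
IsPot {k} P = ∀ t → t ∈ P → ∀ (x : CE k) → occurs x t →
  Σ (Tile k) λ t' → t' ∈ P × occurs (hat x) t'

record Design (k : ℕ) (G : Graph) : Set where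
  field
    lab   : Fin (nE G) → Bool → CE k
    bond  : ∀ e → lab e true ≡ hat (lab e false)
open Design public

sumFin : ∀ n → (Fin n → ℕ) → ℕ
sumFin zero    f = 0
sumFin (suc n) f = f fzero + sumFin n (λ i → f (fsuc i))

indicator : ∀ {A : Set} → Dec A → ℕ
indicator (yes _) = 1
indicator (no _)  = 0

_≟ᶜ_ : ∀ {k} (x y : CE k) → Dec (x ≡ y)
(a , b) ≟ᶜ (c , d) with a ≟ᶠ c | b ≟ᵇ d
... | yes refl | yes refl = yes refl
... | no p | _ = no λ { refl → p refl }
... | yes _ | no q = no λ { refl → q refl }

countAt : ∀ {k G} → Design k G → Fin (nV G) → CE k → ℕ
countAt {k} {G} d v x =
  sumFin (nE G) λ e →
    indicator (ends G e false ≟ᶠ v) * indicator (lab d e false ≟ᶜ x)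
  + indicator (ends G e true ≟ᶠ v)  * indicator (lab d e true ≟ᶜ x)

tileAt : ∀ {k G} → Design k G → Fin (nV G) → Tile k
tileAt d v = tabulate (λ a → countAt d v (a , false))
           , tabulate (λ a → countAt d v (a , true))

UsesPot : ∀ {k G} → Design k G → Pot k → Set
UsesPot {G = G} d P = ∀ (v : Fin (nV G)) → tileAt d v ∈ P

Realizes : ∀ {k} → Pot k → Graph → Set
Realizes {k} P G = Σ (Design k G) λ d → UsesPot d P

InO : ∀ {k} → Pot k → Graph → Set
InO P H = 1 ≤ nV H × Realizes P H

Scenario3 : ∀ {k} → Pot k → Graph → Set
Scenario3 P G =
    InO P G
  × (∀ H → InO P H → nV G ≤ nV H)
  × (∀ H → InO P H → nV H ≡ nV G → Iso H G)

ThreeRepeatedTiles : ∀ {k G} → Design k G → Set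
ThreeRepeatedTiles {G = G} d =
  Σ (Fin (nV G)) λ v₁ → Σ (Fin (nV G)) λ w₁ →
  Σ (Fin (nV G)) λ v₂ → Σ (Fin (nV G)) λ w₂ →
  Σ (Fin (nV G)) λ v₃ → Σ (Fin (nV G)) λ w₃ →
    (v₁ ≢ w₁) × (v₂ ≢ w₂) × (v₃ ≢ w₃)
  × (tileAt d v₁ ≡ tileAt d w₁) × (tileAt d v₂ ≡ tileAt d w₂) × (tileAt d v₃ ≡ tileAt d w₃)
  × (tileAt d v₁ ≢ tileAt d v₂) × (tileAt d v₁ ≢ tileAt d v₃) × (tileAt d v₂ ≢ tileAt d v₃)

{-# OPTIONS --safe #-}
module Submission where

open import Defs
open import Data.Nat using (ℕ; zero; suc; _+_; _*_; _≤_; _<_; z≤n; s≤s)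
open import Data.Nat.Properties using (+-assoc; +-identityʳ; +-cancelʳ-≡; m≤n+m)
open import Data.Nat.Solver using (module +-*-Solver)
open import Data.Bool using (Bool; true; false; not; if_then_else_)
open import Data.Bool.Properties
  using (not-involutive; if-float; if-eta; if-cong-else) renaming (_≟_ to _≟ᵇ_)
open import Data.Fin using (Fin; #_; opposite) renaming (zero to fzero; suc to fsuc)
open import Data.Fin.Properties using (any?; all?) renaming (_≟_ to _≟ᶠ_)
open import Data.Vec using (Vec; lookup; []; _∷_)
open import Data.Vec.Properties using (lookup∘tabulate; tabulate-cong)
open import Data.List.Membership.Propositional using (_∈_)
open import Data.Product using (Σ; ∃; _×_; _,_; proj₁; proj₂; map₁; uncurry)
open import Data.Product.Properties using (,-injective)
open import Data.Sum using (_⊎_; inj₁; inj₂; [_,_]′)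
open import Data.Empty using (⊥; ⊥-elim)
open import Function using (_∘_; id)
open import Function.Bundles using (Inverse; Injection)
open import Function.Properties.Inverse using (↔⇒↣)
open import Relation.Unary using (Decidable)
open import Relation.Nullary using (¬_; Dec; yes; no; does)
open import Relation.Nullary.Decidable
  using (map′; _×-dec_; _⊎-dec_; _→-dec_; ¬?; toWitness; dec-true; dec-false)
open import Relation.Binary.Definitions using (DecidableEquality)
open import Relation.Binary.PropositionalEquality
  using (_≡_; _≢_; refl; sym; trans; cong; cong₂; subst; _≗_; ≢-sym; module ≡-Reasoning)

-- If two half-edges on different edges carry the same label, exchanging their endpoints changes
-- no tile, so by Scenario 3 the resulting graph is again a cube: it has no loops, no parallel
-- edges and no triangles. For suitable choices of the two half-edges this shows that a tile cannot
-- repeat on adjacent or on antipodal vertices, that two vertices with the same tile send equal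
-- labels to a common neighbour, and that two repeated pairs {u, w} and {u′, w′} cannot be linked,
-- i.e. have u′ a common neighbour of u and w and w′ a neighbour of u. Repeated pairs are thus at
-- distance two, and a finite check shows that among any three disjoint such pairs two are linked.

-- Sums over half-edges

-- Unlike Data.Product.Properties.≡-dec its decision bit reduces on open terms, which the
-- induction in sumHalf-update relies on.
_≟ʰ_ : ∀ {n} → DecidableEquality (Fin n × Bool)
(e , s) ≟ʰ (f , t) = map′ (uncurry (cong₂ _,_)) ,-injective ((e ≟ᶠ f) ×-dec (s ≟ᵇ t))

update : ∀ {n} {A : Set} → (Fin n × Bool → A) → Fin n × Bool → A → Fin n × Bool → A
update F h a x = if does (x ≟ʰ h) then a else F x

swap : ∀ {n} → Fin n × Bool → Fin n × Bool → Fin n × Bool → Fin n × Bool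
swap h g = update (update id h g) g h

module _ {n : ℕ} {A : Set} where

  update-id : ∀ (F : Fin n × Bool → A) {h a} → F h ≡ a → update F h a ≗ F
  update-id F {h} Fh≡a x with x ≟ʰ h
  ... | yes refl rewrite dec-true (x ≟ʰ x) refl = sym Fh≡a
  ... | no x≢h   rewrite dec-false (x ≟ʰ h) x≢h = refl

  update-with-value-at : ∀ (F : Fin n × Bool → A) h g → update F h (F g) g ≡ F g
  update-with-value-at F h g = if-eta (does (g ≟ʰ h))

  ∘update : ∀ {B : Set} (F : A → B) (G : Fin n × Bool → A) h a →
            F ∘ update G h a ≗ update (F ∘ G) h (F a)
  ∘update F G h a x = if-float F (does (x ≟ʰ h))

module _ {n : ℕ} where

  swap-right : (h g : Fin n × Bool) → swap h g g ≡ h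
  swap-right h g rewrite dec-true (g ≟ʰ g) refl = refl

  swap-fixes : ∀ {h g x : Fin n × Bool} → x ≢ h → x ≢ g → swap h g x ≡ x
  swap-fixes {h} {g} {x} x≢h x≢g rewrite dec-false (x ≟ʰ g) x≢g | dec-false (x ≟ʰ h) x≢h = refl

  ∘swap≗update : ∀ {A : Set} (F : Fin n × Bool → A) h g →
                 F ∘ swap h g ≗ update (update F h (F g)) g (F h)
  ∘swap≗update F h g x =
    trans (∘update F (update id h g) g h x) (if-cong-else (does (x ≟ʰ g)) (∘update F id h g x))

  swap-invariant : ∀ {A : Set} (F : Fin n × Bool → A) {h g} → F h ≡ F g → F ∘ swap h g ≗ F
  swap-invariant F {h} {g} Fh≡Fg x = begin
    F (swap h g x)                       ≡⟨ ∘swap≗update F h g x ⟩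
    update (update F h (F g)) g (F h) x  ≡⟨ if-cong-else (does (x ≟ʰ g)) (update-id F Fh≡Fg x) ⟩
    update F g (F h) x                   ≡⟨ update-id F (sym Fh≡Fg) x ⟩
    F x                                  ∎
    where open ≡-Reasoning

sumHalf : ∀ n → (Fin n × Bool → ℕ) → ℕ
sumHalf n F = sumFin n λ e → F (e , false) + F (e , true)

sumFin-cong : ∀ n {f g : Fin n → ℕ} → f ≗ g → sumFin n f ≡ sumFin n g
sumFin-cong zero    f≗g = refl
sumFin-cong (suc n) f≗g = cong₂ _+_ (f≗g fzero) (sumFin-cong n (f≗g ∘ fsuc))

sumHalf-cong : ∀ n {F G : Fin n × Bool → ℕ} → F ≗ G → sumHalf n F ≡ sumHalf n G
sumHalf-cong n F≗G = sumFin-cong n λ e → cong₂ _+_ (F≗G (e , false)) (F≗G (e , true))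

-- Stated additively to avoid truncated subtraction.
sumHalf-update : ∀ n (F : Fin n × Bool → ℕ) h a → sumHalf n (update F h a) + F h ≡ sumHalf n F + a
sumHalf-update (suc n) F (fzero , false) a =
  solve 4 (λ a x y r → ((a :+ y) :+ r) :+ x := ((x :+ y) :+ r) :+ a)
        refl a (F (fzero , false)) (F (fzero , true)) (sumHalf n (F ∘ map₁ fsuc))
  where open +-*-Solver
sumHalf-update (suc n) F (fzero , true) a =
  solve 4 (λ a x y r → ((x :+ a) :+ r) :+ y := ((x :+ y) :+ r) :+ a)
        refl a (F (fzero , false)) (F (fzero , true)) (sumHalf n (F ∘ map₁ fsuc))
  where open +-*-Solver
sumHalf-update (suc n) F (fsuc e , s) a = begin
  (A + sumHalf n (update F′ (e , s) a)) + F′ (e , s) ≡⟨ +-assoc A _ _ ⟩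
  A + (sumHalf n (update F′ (e , s) a) + F′ (e , s))
    ≡⟨ cong (A +_) (sumHalf-update n F′ (e , s) a) ⟩
  A + (sumHalf n F′ + a)                               ≡⟨ +-assoc A _ a ⟨
  (A + sumHalf n F′) + a                               ∎
  where
  open ≡-Reasoning
  F′ : Fin n × Bool → ℕ
  F′ = F ∘ map₁ fsuc
  A : ℕ
  A = F (fzero , false) + F (fzero , true)

sumHalf-swap : ∀ n (F : Fin n × Bool → ℕ) h g → sumHalf n (F ∘ swap h g) ≡ sumHalf n F
sumHalf-swap n F h g = +-cancelʳ-≡ (F g) _ _ (begin
  sumHalf n (F ∘ swap h g) + F g             ≡⟨ cong₂ _+_ (sumHalf-cong n (∘swap≗update F h g))
                                                          (sym (update-with-value-at F h g)) ⟩
  sumHalf n (update F₁ g (F h)) + F₁ g       ≡⟨ sumHalf-update n F₁ g (F h) ⟩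
  sumHalf n F₁ + F h                         ≡⟨ sumHalf-update n F h (F g) ⟩
  sumHalf n F + F g                          ∎)
  where
  open ≡-Reasoning
  F₁ : Fin n × Bool → ℕ
  F₁ = update F h (F g)

≤-sumHalf : ∀ n (F : Fin n × Bool → ℕ) h → F h ≤ sumHalf n F
≤-sumHalf n F h =
  subst (F h ≤_) (trans (sumHalf-update n F h 0) (+-identityʳ _)) (m≤n+m (F h) _)

+-positive : ∀ m {n} → 0 < m + n → 0 < m ⊎ 0 < n
+-positive zero    0<n = inj₂ 0<n
+-positive (suc m) _   = inj₁ (s≤s z≤n)

sumHalf-positive : ∀ n (F : Fin n × Bool → ℕ) → 0 < sumHalf n F → ∃ λ h → 0 < F h
sumHalf-positive (suc n) F 0<ΣF with +-positive (F (fzero , false) + F (fzero , true)) 0<ΣF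
... | inj₁ 0<here with +-positive (F (fzero , false)) 0<here
...   | inj₁ 0<F₀ = (fzero , false) , 0<F₀
...   | inj₂ 0<F₁ = (fzero , true) , 0<F₁
sumHalf-positive (suc n) F 0<ΣF | inj₂ 0<rest with sumHalf-positive n (F ∘ map₁ fsuc) 0<rest
... | h , 0<Fh = map₁ fsuc h , 0<Fh

-- Graphs, half-edges and isomorphisms

HalfEdge : Graph → Set
HalfEdge G = Fin (nE G) × Bool

opp : ∀ {n} → Fin n × Bool → Fin n × Bool
opp (e , s) = e , not s

opp-involutive : ∀ {n} (h : Fin n × Bool) → opp (opp h) ≡ h
opp-involutive (e , s) = cong (e ,_) (not-involutive s)

opp-≢ : ∀ {n} (h : Fin n × Bool) → opp h ≢ h
opp-≢ (e , false) ()
opp-≢ (e , true)  ()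

_≁_ : ∀ {n} → Fin n × Bool → Fin n × Bool → Set
h ≁ g = proj₁ h ≢ proj₁ g

same-edge : ∀ {n} {h g : Fin n × Bool} → proj₁ h ≡ proj₁ g → h ≡ g ⊎ h ≡ opp g
same-edge {h = e , false} {g = e , false} refl = inj₁ refl
same-edge {h = e , true}  {g = e , true}  refl = inj₁ refl
same-edge {h = e , false} {g = e , true}  refl = inj₂ refl
same-edge {h = e , true}  {g = e , false} refl = inj₂ refl

end : (G : Graph) → HalfEdge G → Fin (nV G)
end G h = ends G (proj₁ h) (proj₂ h)

record Joins (G : Graph) (h : HalfEdge G) (a b : Fin (nV G)) : Set where
  constructor joins
  field
    here  : end G h ≡ a
    there : end G (opp h) ≡ b
open Joins public

Adjacent : (G : Graph) → Fin (nV G) → Fin (nV G) → Set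
Adjacent G a b = Σ (HalfEdge G) λ h → Joins G h a b

NoParallelEdges : Graph → Set
NoParallelEdges G = ∀ {a b} (h g : HalfEdge G) → Joins G h a b → Joins G g a b → proj₁ h ≡ proj₁ g

-- Closed walks of length three are excluded, so in particular loops are.
TriangleFree : Graph → Set
TriangleFree G = ∀ {a b c} → Adjacent G a b → Adjacent G b c → Adjacent G c a → ⊥

module _ {G : Graph} where

  joins-opp : ∀ {h a b} → Joins G h a b → Joins G (opp h) b a
  joins-opp {h} (joins h↦a oh↦b) = joins oh↦b (trans (cong (end G) (opp-involutive h)) h↦a)

  adjacent-irreflexive : TriangleFree G → ∀ {a b} → Adjacent G a b → a ≢ b
  adjacent-irreflexive triangle-free a~b refl = triangle-free a~b a~b a~b

  edges-differ : ∀ (f : HalfEdge G) {h a c d} → end G f ≡ a → Joins G h c d → a ≢ c → a ≢ d → f ≁ h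
  edges-differ f {h} f↦a (joins h↦c oh↦d) a≢c a≢d f∼h with same-edge {h = f} {g = h} f∼h
  ... | inj₁ refl = a≢c (trans (sym f↦a) h↦c)
  ... | inj₂ refl = a≢d (trans (sym f↦a) oh↦d)

module _ {H G : Graph} (iso : Iso H G) where

  private
    φ : Fin (nV H) → Fin (nV G)
    φ = Inverse.to (Iso.vmap iso)
    ψ : Fin (nE H) → Fin (nE G)
    ψ = Inverse.to (Iso.emap iso)

  iso-joins : ∀ {h a b} → Joins H h a b →
              Σ (HalfEdge G) λ h′ → proj₁ h′ ≡ ψ (proj₁ h) × Joins G h′ (φ a) (φ b)
  iso-joins {e , s} (joins refl refl) with Iso.compat iso e | s
  ... | inj₁ (ψe₀ , ψe₁) | false = (ψ e , false) , refl , joins ψe₀ ψe₁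
  ... | inj₁ (ψe₀ , ψe₁) | true  = (ψ e , true)  , refl , joins ψe₁ ψe₀
  ... | inj₂ (ψe₀ , ψe₁) | false = (ψ e , true)  , refl , joins ψe₁ ψe₀
  ... | inj₂ (ψe₀ , ψe₁) | true  = (ψ e , false) , refl , joins ψe₀ ψe₁

  iso-adjacent : ∀ {a b} → Adjacent H a b → Adjacent G (φ a) (φ b)
  iso-adjacent (h , jh) = let h′ , _ , jh′ = iso-joins jh in h′ , jh′

  iso-triangleFree : TriangleFree G → TriangleFree H
  iso-triangleFree triangle-free a~b b~c c~a =
    triangle-free (iso-adjacent a~b) (iso-adjacent b~c) (iso-adjacent c~a)

  iso-noParallelEdges : NoParallelEdges G → NoParallelEdges H
  iso-noParallelEdges no-parallel h g jh jg with iso-joins jh | iso-joins jg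
  ... | h′ , ψh≡ , jh′ | g′ , ψg≡ , jg′ =
    Injection.injective (↔⇒↣ (Iso.emap iso))
      (trans (sym ψh≡) (trans (no-parallel h′ g′ jh′ jg′) ψg≡))

-- Labels and tiles

indicator-yes : ∀ {A : Set} (a? : Dec A) → A → indicator a? ≡ 1
indicator-yes (yes _) _ = refl
indicator-yes (no ¬a) a = ⊥-elim (¬a a)

indicator-product-positive : ∀ {A B : Set} (a? : Dec A) (b? : Dec B) →
                             0 < indicator a? * indicator b? → A × B
indicator-product-positive (yes a) (yes b) _  = a , b
indicator-product-positive (yes _) (no _)  ()
indicator-product-positive (no _)  _       ()

hat-involutive : ∀ {k} (x : CE k) → hat (hat x) ≡ x
hat-involutive (a , s) = cong (a ,_) (not-involutive s)

hat-injective : ∀ {k} {x y : CE k} → hat x ≡ hat y → x ≡ y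
hat-injective {x = x} {y} hx≡hy =
  trans (sym (hat-involutive x)) (trans (cong hat hx≡hy) (hat-involutive y))

hat-≢ : ∀ {k} (x : CE k) → hat x ≢ x
hat-≢ (a , false) ()
hat-≢ (a , true)  ()

module _ {k : ℕ} {G : Graph} (d : Design k G) where

  label : HalfEdge G → CE k
  label h = lab d (proj₁ h) (proj₂ h)

  label-opp : ∀ h → label (opp h) ≡ hat (label h)
  label-opp (e , false) = bond d e
  label-opp (e , true)  = trans (sym (hat-involutive _)) (cong hat (sym (bond d e)))

  labels-differ-edges-differ : ∀ {f h a b} → Joins G f a b → end G h ≡ a → a ≢ b →
                               label f ≢ label h → f ≁ h
  labels-differ-edges-differ {f} {h} (joins f↦a of↦b) h↦a a≢b f≉h f∼h
    with same-edge {h = f} {g = h} f∼h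
  ... | inj₁ refl = f≉h refl
  ... | inj₂ refl = a≢b (trans (sym h↦a) (trans (cong (end G) (sym (opp-involutive h))) of↦b))

  -- countAt d v x unfolds to sumHalf (nE G) (incidence v x).
  incidence : Fin (nV G) → CE k → HalfEdge G → ℕ
  incidence v x h = indicator (end G h ≟ᶠ v) * indicator (label h ≟ᶜ x)

  mult-tileAt : ∀ v x → mult (tileAt d v) x ≡ countAt d v x
  mult-tileAt v (a , false) = lookup∘tabulate (λ b → countAt d v (b , false)) a
  mult-tileAt v (a , true)  = lookup∘tabulate (λ b → countAt d v (b , true)) a

  countAt-tileAt : ∀ {v w} → tileAt d v ≡ tileAt d w → ∀ x → countAt d v x ≡ countAt d w x
  countAt-tileAt {v} {w} v≈w x =
    trans (sym (mult-tileAt v x)) (trans (cong (λ t → mult t x) v≈w) (mult-tileAt w x))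

  label-transfer : ∀ {v w} → tileAt d v ≡ tileAt d w → ∀ {g} → end G g ≡ w →
                   Σ (HalfEdge G) λ h → end G h ≡ v × label h ≡ label g
  label-transfer {v} {w} v≈w {g} g↦w =
    let h , 0<incidence = sumHalf-positive (nE G) (incidence v x) 0<count
    in h , indicator-product-positive (end G h ≟ᶠ v) (label h ≟ᶜ x) 0<incidence
    where
    x : CE k
    x = label g
    g-counted : incidence w x g ≡ 1
    g-counted = cong₂ _*_ (indicator-yes (end G g ≟ᶠ w) g↦w) (indicator-yes (x ≟ᶜ x) refl)
    0<count : 0 < countAt d v x
    0<count = subst (0 <_) (sym (countAt-tileAt v≈w x))
      (subst (_≤ countAt d w x) g-counted (≤-sumHalf (nE G) (incidence w x) g))

-- Switching two half-edges

switch : (G : Graph) → HalfEdge G → HalfEdge G → Graph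
switch G h g = record G { ends = λ e s → end G (swap h g (e , s)) }

switchDesign : ∀ {k G} → Design k G → (h g : HalfEdge G) → Design k (switch G h g)
switchDesign d h g = record { lab = lab d ; bond = bond d }

tileAt-switch : ∀ {k G} (d : Design k G) {h g} → label d h ≡ label d g →
                ∀ v → tileAt (switchDesign d h g) v ≡ tileAt d v
tileAt-switch {G = G} d {h} {g} same v =
  cong₂ _,_ (tabulate-cong λ a → count≡ (a , false)) (tabulate-cong λ a → count≡ (a , true))
  where
  count≡ : ∀ x → countAt (switchDesign d h g) v x ≡ countAt d v x
  count≡ x = trans
    (sumHalf-cong (nE G) λ y →
      cong (λ z → indicator (end G (swap h g y) ≟ᶠ v) * indicator (z ≟ᶜ x))
           (sym (swap-invariant (label d) same y)))
    (sumHalf-swap (nE G) (incidence d v x) h g)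

module _ (G : Graph) (h g : HalfEdge G) where

  joins-switch-right : h ≁ g → Joins (switch G h g) g (end G h) (end G (opp g))
  joins-switch-right h≁g = joins
    (cong (end G) (swap-right h g))
    (cong (end G) (swap-fixes (λ og≡h → h≁g (cong proj₁ (sym og≡h))) (λ og≡g → opp-≢ g og≡g)))

  joins-switch-other : ∀ {f a b} → f ≁ h → f ≁ g → Joins G f a b → Joins (switch G h g) f a b
  joins-switch-other {f} f≁h f≁g (joins f↦a of↦b) = joins
    (trans (cong (end G) (swap-fixes (f≁h ∘ cong proj₁) (f≁g ∘ cong proj₁))) f↦a)
    (trans (cong (end G) (swap-fixes (f≁h ∘ cong proj₁) (f≁g ∘ cong proj₁))) of↦b)

-- Consequences of Scenario 3

record RepeatedTile {k G} (d : Design k G) (v w : Fin (nV G)) : Set where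
  constructor repeated
  field
    distinct  : v ≢ w
    same-tile : tileAt d v ≡ tileAt d w

repeatedTile-sym : ∀ {k G} {d : Design k G} {v w} → RepeatedTile d v w → RepeatedTile d w v
repeatedTile-sym (repeated v≢w v≈w) = repeated (≢-sym v≢w) (sym v≈w)

Linked : (G : Graph) → (u w u′ w′ : Fin (nV G)) → Set
Linked G u w u′ w′ = Adjacent G u u′ × Adjacent G u′ w × Adjacent G u w′

LinkedPairs : (G : Graph) → (u w u′ w′ : Fin (nV G)) → Set
LinkedPairs G u w u′ w′ =
  Linked G u w u′ w′ ⊎ Linked G u w w′ u′ ⊎ Linked G w u u′ w′ ⊎ Linked G w u w′ u′

Interlocked : (G : Graph) → (u w u′ w′ : Fin (nV G)) → Set
Interlocked G u w u′ w′ = LinkedPairs G u w u′ w′ ⊎ LinkedPairs G u′ w′ u w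

module Switching {k : ℕ} {G : Graph} {P : Pot k} (scenario : Scenario3 P G)
                 (no-parallel : NoParallelEdges G) (triangle-free : TriangleFree G)
                 {d : Design k G} (uses : UsesPot d P) where

  switch-iso : ∀ {h g} → label d h ≡ label d g → Iso (switch G h g) G
  switch-iso {h} {g} same = proj₂ (proj₂ scenario) (switch G h g)
    (proj₁ (proj₁ scenario) , switchDesign d h g ,
     λ v → subst (_∈ P) (sym (tileAt-switch d same v)) (uses v))
    refl

  module _ {h g : HalfEdge G} (same : label d h ≡ label d g) (h≁g : h ≁ g) {a b : Fin (nV G)}
           (h↦a : end G h ≡ a) (og↦b : end G (opp g) ≡ b) where

    private
      g-switched : Joins (switch G h g) g a b
      g-switched =
        let joins h↦ og↦ = joins-switch-right G h g h≁g in joins (trans h↦ h↦a) (trans og↦ og↦b)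

    switch-loop : a ≢ b
    switch-loop =
      adjacent-irreflexive (iso-triangleFree (switch-iso same) triangle-free) (g , g-switched)

    switch-parallel : ∀ {f} → f ≁ h → f ≁ g → ¬ Joins G f a b
    switch-parallel f≁h f≁g jf =
      f≁g (iso-noParallelEdges (switch-iso same) no-parallel _ g
             (joins-switch-other G h g f≁h f≁g jf) g-switched)

    switch-triangle : ∀ {f₁ f₂ c} → f₁ ≁ h → f₁ ≁ g → f₂ ≁ h → f₂ ≁ g →
                      Joins G f₁ a c → Joins G f₂ b c → ⊥
    switch-triangle {f₁} {f₂} f₁≁h f₁≁g f₂≁h f₂≁g j₁ j₂ =
      iso-triangleFree (switch-iso same) triangle-free
        (g , g-switched)
        (f₂ , joins-switch-other G h g f₂≁h f₂≁g j₂)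
        (opp f₁ , joins-opp {G = switch G h g} {h = f₁} (joins-switch-other G h g f₁≁h f₁≁g j₁))

  adjacent-tiles-differ : ∀ {v w} → Adjacent G v w → tileAt d v ≢ tileAt d w
  adjacent-tiles-differ {v} {w} (h , jh) v≈w with label-transfer d v≈w (there jh)
  ... | h′ , h′↦v , h′~oh = switch-loop h′~oh (≢-sym h≁h′) h′↦v (there (joins-opp jh)) refl
    where
    h≁h′ : h ≁ h′
    h≁h′ = labels-differ-edges-differ d jh h′↦v (adjacent-irreflexive triangle-free (h , jh))
      λ h~h′ → hat-≢ (label d h) (sym (trans h~h′ (trans h′~oh (label-opp d h))))

  common-neighbour-labels : ∀ {v w x f g} → RepeatedTile d v w → Joins G f v x → Joins G g w x →
                            label d f ≡ label d g
  common-neighbour-labels {v} {w} {x} {f} {g} (repeated v≢w v≈w) jf jg with label d f ≟ᶜ label d g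
  ... | yes f~g = f~g
  ... | no f≉g with label-transfer d v≈w (here jg)
  ...   | h , h↦v , h~g = ⊥-elim (switch-parallel h~g h≁g h↦v (there jg) f≁h f≁g jf)
    where
    v≢x : v ≢ x
    v≢x = adjacent-irreflexive triangle-free (f , jf)
    h≁g : h ≁ g
    h≁g = edges-differ h h↦v jg v≢w v≢x
    f≁g : f ≁ g
    f≁g = edges-differ f (here jf) jg v≢w v≢x
    f≁h : f ≁ h
    f≁h = labels-differ-edges-differ d jf h↦v v≢x (λ f~h → f≉g (trans f~h h~g))

  linked-impossible : ∀ {u w u′ w′} → RepeatedTile d u w → RepeatedTile d u′ w′ →
                      ¬ Linked G u w u′ w′
  linked-impossible {u} {w} {u′} {w′} r r′ ((f , jf) , (g₀ , jg₀) , (h , jh)) =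
    switch-parallel h~g h≁g (here jh) (there jg) f≁h f≁g jf
    where
    g : HalfEdge G
    g = opp g₀
    jg : Joins G g w u′
    jg = joins-opp jg₀
    f~h : label d f ≡ label d h
    f~h = hat-injective (begin
      hat (label d f)     ≡⟨ label-opp d f ⟨
      label d (opp f)     ≡⟨ common-neighbour-labels r′ (joins-opp jf) (joins-opp jh) ⟩
      label d (opp h)     ≡⟨ label-opp d h ⟩
      hat (label d h)     ∎)
      where open ≡-Reasoning
    h~g : label d h ≡ label d g
    h~g = trans (sym f~h) (common-neighbour-labels r jf jg)
    u≢u′ : u ≢ u′
    u≢u′ = adjacent-irreflexive triangle-free (f , jf)
    h≁g : h ≁ g
    h≁g = edges-differ h (here jh) jg (RepeatedTile.distinct r) u≢u′
    f≁g : f ≁ g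
    f≁g = edges-differ f (here jf) jg (RepeatedTile.distinct r) u≢u′
    f≁h : f ≁ h
    f≁h = edges-differ (opp f) (there jf) jh (≢-sym u≢u′) (RepeatedTile.distinct r′)

  linkedPairs-impossible : ∀ {u w u′ w′} → RepeatedTile d u w → RepeatedTile d u′ w′ →
                           ¬ LinkedPairs G u w u′ w′
  linkedPairs-impossible r r′ (inj₁ l) = linked-impossible r r′ l
  linkedPairs-impossible r r′ (inj₂ (inj₁ l)) = linked-impossible r (repeatedTile-sym r′) l
  linkedPairs-impossible r r′ (inj₂ (inj₂ (inj₁ l))) = linked-impossible (repeatedTile-sym r) r′ l
  linkedPairs-impossible r r′ (inj₂ (inj₂ (inj₂ l))) =
    linked-impossible (repeatedTile-sym r) (repeatedTile-sym r′) l

  interlocked-impossible : ∀ {u w u′ w′} → RepeatedTile d u w → RepeatedTile d u′ w′ →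
                           ¬ Interlocked G u w u′ w′
  interlocked-impossible r r′ = [ linkedPairs-impossible r r′ , linkedPairs-impossible r′ r ]′

-- The cube

-- Row v lists the vertices obtained from v by flipping one of its three bits.
bitFlips : Vec (Vec (Fin 8) 3) 8
bitFlips =
  (# 1 ∷ # 2 ∷ # 4 ∷ []) ∷ (# 0 ∷ # 3 ∷ # 5 ∷ []) ∷
  (# 3 ∷ # 0 ∷ # 6 ∷ []) ∷ (# 2 ∷ # 1 ∷ # 7 ∷ []) ∷
  (# 5 ∷ # 6 ∷ # 0 ∷ []) ∷ (# 4 ∷ # 7 ∷ # 1 ∷ []) ∷
  (# 7 ∷ # 4 ∷ # 2 ∷ []) ∷ (# 6 ∷ # 5 ∷ # 3 ∷ []) ∷ []

bitFlip : Fin 8 → Fin 3 → Fin 8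
bitFlip v i = lookup (lookup bitFlips v) i

-- opposite v = 7 - v flips all three bits.
antipode : Fin 8 → Fin 8
antipode = opposite

module _ {n : ℕ} {P : Fin n × Bool → Set} (P? : Decidable P) where

  all-halfEdges? : Dec (∀ h → P h)
  all-halfEdges? = map′ (λ all (e , s) → by-side (all e) s)
                        (λ all e → all (e , false) , all (e , true))
                        (all? λ e → P? (e , false) ×-dec P? (e , true))
    where
    by-side : ∀ {e} → P (e , false) × P (e , true) → ∀ s → P (e , s)
    by-side (p , _) false = p
    by-side (_ , p) true  = p

  any-halfEdge? : Dec (∃ P)
  any-halfEdge? = map′ (λ { (e , inj₁ p) → (e , false) , p ; (e , inj₂ p) → (e , true) , p })
                       (λ { ((e , false) , p) → e , inj₁ p ; ((e , true) , p) → e , inj₂ p })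
                       (any? λ e → P? (e , false) ⊎-dec P? (e , true))

joins? : ∀ G h a b → Dec (Joins G h a b)
joins? G h a b =
  map′ (uncurry joins) (λ j → here j , there j) ((end G h ≟ᶠ a) ×-dec (end G (opp h) ≟ᶠ b))

bitFlip-adjacent : ∀ a i → Adjacent cube a (bitFlip a i)
bitFlip-adjacent =
  toWitness {a? = all? λ a → all? λ i → any-halfEdge? λ h → joins? cube h a (bitFlip a i)} _

adjacent⇒bitFlip : ∀ {a b} → Adjacent cube a b → ∃ λ i → bitFlip a i ≡ b
adjacent⇒bitFlip (h , joins refl refl) = toWitness
  {a? = all-halfEdges? λ h → any? λ i → bitFlip (end cube h) i ≟ᶠ end cube (opp h)} _ h

adjacent? : ∀ a b → Dec (Adjacent cube a b)
adjacent? a b =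
  map′ (λ { (i , refl) → bitFlip-adjacent a i }) adjacent⇒bitFlip (any? λ i → bitFlip a i ≟ᶠ b)

cube-noParallelEdges : NoParallelEdges cube
cube-noParallelEdges h g (joins h↦a oh↦b) (joins g↦a og↦b) =
  toWitness {a? = all-halfEdges? λ h → all-halfEdges? λ g →
                    (end cube h ≟ᶠ end cube g) →-dec (end cube (opp h) ≟ᶠ end cube (opp g)) →-dec
                    (proj₁ h ≟ᶠ proj₁ g)} _
    h g (trans h↦a (sym g↦a)) (trans oh↦b (sym og↦b))

cube-triangleFree : TriangleFree cube
cube-triangleFree {a} {b} {c} a~b b~c c~a =
  toWitness {a? = all? λ a → all? λ b → all? λ c →
                    ¬? (adjacent? a b ×-dec adjacent? b c ×-dec adjacent? c a)} _
    a b c (a~b , b~c , c~a)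

antipode-≢ : ∀ v → v ≢ antipode v
antipode-≢ = toWitness {a? = all? λ v → ¬? (v ≟ᶠ antipode v)} _

-- A neighbour y of the antipode of v is at distance two from v, so v and y have two common
-- neighbours and one of them avoids any given neighbour b of v.
antipodal-detour : ∀ v b y → Adjacent cube v b → Adjacent cube (antipode v) y →
                   (y ≢ v × y ≢ b) ×
                   Σ (Fin 8) λ z → Adjacent cube v z × Adjacent cube y z × z ≢ b × z ≢ antipode v
antipodal-detour = toWitness {a? = all? λ v → all? λ b → all? λ y →
  adjacent? v b →-dec adjacent? (antipode v) y →-dec
    (¬? (y ≟ᶠ v) ×-dec ¬? (y ≟ᶠ b)) ×-dec
    any? λ z → adjacent? v z ×-dec adjacent? y z ×-dec ¬? (z ≟ᶠ b) ×-dec ¬? (z ≟ᶠ antipode v)} _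

AtDistanceTwo : Fin 8 → Fin 8 → Set
AtDistanceTwo v w = v ≢ w × ¬ Adjacent cube v w × w ≢ antipode v

atDistanceTwo? : ∀ v w → Dec (AtDistanceTwo v w)
atDistanceTwo? v w = ¬? (v ≟ᶠ w) ×-dec ¬? (adjacent? v w) ×-dec ¬? (w ≟ᶠ antipode v)

Disjoint : ∀ {A : Set} → A → A → A → A → Set
Disjoint v w v′ w′ = v ≢ v′ × v ≢ w′ × w ≢ v′ × w ≢ w′

disjoint? : ∀ {n} (v w v′ w′ : Fin n) → Dec (Disjoint v w v′ w′)
disjoint? v w v′ w′ = ¬? (v ≟ᶠ v′) ×-dec ¬? (v ≟ᶠ w′) ×-dec ¬? (w ≟ᶠ v′) ×-dec ¬? (w ≟ᶠ w′)

linked? : ∀ u w u′ w′ → Dec (Linked cube u w u′ w′)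
linked? u w u′ w′ = adjacent? u u′ ×-dec adjacent? u′ w ×-dec adjacent? u w′

linkedPairs? : ∀ u w u′ w′ → Dec (LinkedPairs cube u w u′ w′)
linkedPairs? u w u′ w′ =
  linked? u w u′ w′ ⊎-dec linked? u w w′ u′ ⊎-dec linked? w u u′ w′ ⊎-dec linked? w u w′ u′

interlocked? : ∀ u w u′ w′ → Dec (Interlocked cube u w u′ w′)
interlocked? u w u′ w′ = linkedPairs? u w u′ w′ ⊎-dec linkedPairs? u′ w′ u w

-- Pairs at distance two lie inside one of the two colour classes of the cube (each of size four),
-- so two of the three pairs partition a class; the third pair then has a common neighbour u′
-- in that class whose partner w′ is adjacent to one of its vertices.
three-pairs-interlock :
  ∀ v₁ w₁ → AtDistanceTwo v₁ w₁ →
  ∀ v₂ w₂ → AtDistanceTwo v₂ w₂ → Disjoint v₁ w₁ v₂ w₂ →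
  ∀ v₃ w₃ → AtDistanceTwo v₃ w₃ → Disjoint v₁ w₁ v₃ w₃ → Disjoint v₂ w₂ v₃ w₃ →
  Interlocked cube v₁ w₁ v₂ w₂ ⊎ Interlocked cube v₁ w₁ v₃ w₃ ⊎ Interlocked cube v₂ w₂ v₃ w₃
three-pairs-interlock = toWitness {a? =
  all? λ v₁ → all? λ w₁ → atDistanceTwo? v₁ w₁ →-dec
  (all? λ v₂ → all? λ w₂ → atDistanceTwo? v₂ w₂ →-dec disjoint? v₁ w₁ v₂ w₂ →-dec
  (all? λ v₃ → all? λ w₃ → atDistanceTwo? v₃ w₃ →-dec
                           disjoint? v₁ w₁ v₃ w₃ →-dec disjoint? v₂ w₂ v₃ w₃ →-dec
    (interlocked? v₁ w₁ v₂ w₂ ⊎-dec interlocked? v₁ w₁ v₃ w₃ ⊎-dec interlocked? v₂ w₂ v₃ w₃)))} _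

module CubeTiles {k : ℕ} {P : Pot k} (scenario : Scenario3 P cube)
                 {d : Design k cube} (uses : UsesPot d P) where

  open Switching scenario cube-noParallelEdges cube-triangleFree {d = d} uses public

  antipodal-triangle : ∀ {v b h g} → Joins cube h v b → end cube g ≡ antipode v →
                       label d h ≡ label d g → ⊥
  antipodal-triangle {v} {b} {h} {g} jh g↦v̄ h~g =
    closing (antipodal-detour v b y (h , jh) (g , jg))
    where
    y : Fin 8
    y = end cube (opp g)
    jg : Joins cube g (antipode v) y
    jg = joins g↦v̄ refl
    closing : (y ≢ v × y ≢ b) ×
              Σ (Fin 8) (λ z → Adjacent cube v z × Adjacent cube y z × z ≢ b × z ≢ antipode v) → ⊥
    closing ((y≢v , y≢b) , z , (f₁ , j₁) , (f₂ , j₂) , z≢b , z≢v̄) =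
      switch-triangle h~g h≁g (here jh) refl f₁≁h f₁≁g f₂≁h f₂≁g j₁ j₂
      where
      h≁g : h ≁ g
      h≁g = edges-differ h (here jh) jg (antipode-≢ v) (≢-sym y≢v)
      f₁≁h : f₁ ≁ h
      f₁≁h = edges-differ (opp f₁) (there j₁) jh
               (≢-sym (adjacent-irreflexive cube-triangleFree (f₁ , j₁))) z≢b
      f₁≁g : f₁ ≁ g
      f₁≁g = edges-differ f₁ (here j₁) jg (antipode-≢ v) (≢-sym y≢v)
      f₂≁h : f₂ ≁ h
      f₂≁h = edges-differ f₂ (here j₂) jh y≢v y≢b
      f₂≁g : f₂ ≁ g
      f₂≁g = edges-differ (opp f₂) (there j₂) jg z≢v̄
               (≢-sym (adjacent-irreflexive cube-triangleFree (f₂ , j₂)))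

  antipodal-tiles-differ : ∀ v → tileAt d v ≢ tileAt d (antipode v)
  -- The vertices are passed explicitly: inferring them from v≈v̄ would normalise tileAt.
  antipodal-tiles-differ v v≈v̄ =
    let h , jh = bitFlip-adjacent v fzero
        g , g↦v̄ , g~h = label-transfer d {antipode v} {v} (sym v≈v̄) (here jh)
    in antipodal-triangle jh g↦v̄ (sym g~h)

  repeatedTile-atDistanceTwo : ∀ {v w} → RepeatedTile d v w → AtDistanceTwo v w
  repeatedTile-atDistanceTwo {v} (repeated v≢w v≈w) =
    v≢w , (λ v~w → adjacent-tiles-differ v~w v≈w) ,
    λ w≡v̄ → antipodal-tiles-differ v (trans v≈w (cong (tileAt d) w≡v̄))

disjoint-of-fibres : ∀ {A B : Set} (f : A → B) {v w v′ w′} → f v ≡ f w → f v′ ≡ f w′ → f v ≢ f v′ →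
                     Disjoint v w v′ w′
disjoint-of-fibres f fv≡fw fv′≡fw′ fv≢fv′ =
  (λ { refl → fv≢fv′ refl }) , (λ { refl → fv≢fv′ (sym fv′≡fw′) }) ,
  (λ { refl → fv≢fv′ fv≡fw }) , (λ { refl → fv≢fv′ (trans fv≡fw (sym fv′≡fw′)) })

lemma6 : ∀ (k : ℕ) (P : Pot k) → IsPot P → Scenario3 P cube →
    (d : Design k cube) → UsesPot d P → ¬ ThreeRepeatedTiles d
lemma6 k P _ scenario d uses (v₁ , w₁ , v₂ , w₂ , v₃ , w₃ , v₁≢w₁ , v₂≢w₂ , v₃≢w₃ ,
                              t₁ , t₂ , t₃ , t₁≢t₂ , t₁≢t₃ , t₂≢t₃) =
  [ interlocked-impossible r₁ r₂ ,
    [ interlocked-impossible r₁ r₃ , interlocked-impossible r₂ r₃ ]′ ]′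
    (three-pairs-interlock
      v₁ w₁ (repeatedTile-atDistanceTwo r₁)
      v₂ w₂ (repeatedTile-atDistanceTwo r₂) (disjoint-of-fibres (tileAt d) t₁ t₂ t₁≢t₂)
      v₃ w₃ (repeatedTile-atDistanceTwo r₃) (disjoint-of-fibres (tileAt d) t₁ t₃ t₁≢t₃)
                                            (disjoint-of-fibres (tileAt d) t₂ t₃ t₂≢t₃))
  where
  open CubeTiles scenario {d = d} uses
  r₁ : RepeatedTile d v₁ w₁
  r₁ = repeated v₁≢w₁ t₁
  r₂ : RepeatedTile d v₂ w₂
  r₂ = repeated v₂≢w₂ t₂
  r₃ : RepeatedTile d v₃ w₃
  r₃ = repeated v₃≢w₃ t₃
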